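{- For every constant positive integer $k$ there are infinitely many $n$ for which there exists a $k$-th order sensitive Boolean function $f$ on $n$ variables with $\mathrm{pdeg}(f)=n^{\frac{\log k}{\log (k+1)}}$ if $k$ is even, and $\mathrm{pdeg}(f)=n^{\frac{\log(k+1)}{\log(k+2)}}$ if $k$ is odd.
   Context: $\mathrm{pdeg}$ is the real polynomial degree (degree of the unique multilinear real polynomial agreeing with $f$ on the Boolean cube). For $S\subseteq[n]$, $\mathbf{x}^{(S)}$ is $\mathbf{x}$ with the bits in $S$ flipped; $f$ is $k$-th order sensitive if there is $\mathbf{x}$ with $f(\mathbf{x})\ne f(\mathbf{x}^{(S)})$ for all $S$ with $1\le|S|\le k$. -}

module Defs where

open import Data.Bool using (Bool; true; false; _xor_; _∧_; if_then_else_)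
open import Data.Nat using (ℕ; zero; suc; _≤_; _<_; _^_)
import Data.Nat as ℕ
open import Data.Integer using (ℤ; +_) renaming (_+_ to _+ℤ_; _*_ to _*ℤ_)
open import Data.Vec using (Vec; []; _∷_; zipWith)
open import Data.List using (List; []; _∷_; map; _++_)
open import Data.Product using (Σ; _×_; ∃)
open import Relation.Binary.PropositionalEquality using (_≡_; _≢_)
open import Function.Bundles using (_⇔_)

-- Points of the Boolean cube {0,1}^n, and subsets of [n] (characteristic vectors).
Cube : ℕ → Set
Cube n = Vec Bool n

BoolFun : ℕ → Set
BoolFun n = Cube n → Bool

card : ∀ {n} → Vec Bool n → ℕ
card []          = 0
card (true ∷ v)  = suc (card v)
card (false ∷ v) = card v

flip : ∀ {n} → Vec Bool n → Cube n → Cube n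
flip S x = zipWith _xor_ S x

KthOrderSensitive : ∀ {n} → ℕ → BoolFun n → Set
KthOrderSensitive {n} k f =
  ∃ λ (x : Cube n) → ∀ (S : Vec Bool n) → 1 ≤ card S → card S ≤ k → f x ≢ f (flip S x)

allVecs : (n : ℕ) → List (Vec Bool n)
allVecs zero    = [] ∷ []
allVecs (suc n) = map (false ∷_) (allVecs n) ++ map (true ∷_) (allVecs n)

sumℤ : List ℤ → ℤ
sumℤ []       = + 0
sumℤ (z ∷ zs) = z +ℤ sumℤ zs

monomial : ∀ {n} → Vec Bool n → Cube n → ℤ
monomial []          []      = + 1
monomial (false ∷ S) (_ ∷ x) = monomial S x
monomial (true ∷ S)  (b ∷ x) = if b then monomial S x else + 0

-- A multilinear polynomial in n variables: a coefficient for each subset S ⊆ [n].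
MultilinearPoly : ℕ → Set
MultilinearPoly n = Vec Bool n → ℤ

eval : ∀ {n} → MultilinearPoly n → Cube n → ℤ
eval {n} c x = sumℤ (map (λ S → c S *ℤ monomial S x) (allVecs n))

toℤ : Bool → ℤ
toℤ true  = + 1
toℤ false = + 0

HasDegree : ∀ {n} → MultilinearPoly n → ℕ → Set
HasDegree {n} c d =
  (∃ λ (S : Vec Bool n) → (c S ≢ + 0) × (card S ≡ d)) ×
  (∀ (S : Vec Bool n) → c S ≢ + 0 → card S ≤ d)

-- pdeg f = d : the (unique) multilinear polynomial agreeing with f on the cube
-- has degree d.  (Its coefficients are integers, so ℤ-coefficients suffice.)
HasPdeg : ∀ {n} → BoolFun n → ℕ → Set
HasPdeg {n} f d =
  ∃ λ (c : MultilinearPoly n) → (∀ (x : Cube n) → eval c x ≡ toℤ (f x)) × HasDegree c d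

-- d = n ^ (log a / log b), for n ≥ 2, a ≥ 1, b ≥ 2, stated exactly via Dedekind cuts:
-- the reals log d / log n and log a / log b agree on every rational p/q, i.e.
-- q·log d < p·log n ⇔ q·log a < p·log b, and likewise for >.
IsPowLogRatio : (d n a b : ℕ) → Set
IsPowLogRatio d n a b =
  2 ≤ n ×
  (∀ (p q : ℕ) → 1 ≤ q →
     ((d ^ q < n ^ p) ⇔ (a ^ q < b ^ p)) × ((n ^ p < d ^ q) ⇔ (b ^ p < a ^ q)))

-- Let K be even and g = OR ∧ ¬AND on K + 1 bits ("not constant").  Its multilinear polynomial
-- 1 - ∏ (1 - zᵢ) - ∏ zᵢ has degree K: the coefficient of z₁⋯z_{K+1} is -(-1)^(K+1) - 1 = 0.
-- Compose g with itself m times on n = (K + 1)^m variables, block by block.  Since g and all its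
-- iterates vanish at 0, the coefficient of a set S in the composed polynomial is the outer
-- coefficient of the set of blocks S meets times the inner coefficients of those blocks; hence
-- degrees multiply and pdeg = K^m = n^(log K / log (K + 1)).  A set of at most K bits meets at
-- most K of the K + 1 blocks, so the block values are never all true and every iterate equals OR
-- on such sets: flipping any 1 ≤ |S| ≤ K bits of the all-zero input changes the value.  Take
-- K = k for even k and K = k + 1 for odd k.

module Submission where

open import Defs
open import Data.Bool using (Bool; true; false; _∨_; _∧_; not; if_then_else_)
open import Data.Bool.Properties using (∧-identityʳ)
open import Data.Nat as ℕ using (ℕ; zero; suc; _≤_; _<_; _^_; z≤n; s≤s)
  renaming (_+_ to _+ℕ_; _*_ to _*ℕ_)
import Data.Nat.Properties as ℕ
open import Data.Nat.Divisibility using (_∣_; _∣?_; divides; ∣-refl; ∣m∣n⇒∣m+n)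
open import Data.Integer using (ℤ; -_; _-_; 0ℤ; 1ℤ; _+_; _*_; _≟_)
import Data.Integer.Properties as ℤ
open import Data.Integer.Tactic.RingSolver using (solve-∀)
open import Data.Vec using (Vec; []; _∷_; _++_; replicate; take; drop; concat; map)
open import Data.Vec.Properties using (take++drop≡id; ++-injectiveˡ; ++-injectiveʳ; ∷-injectiveʳ)
import Data.List as List
import Data.List.Properties as Listₚ
open import Data.Product using (_×_; ∃; _,_)
open import Data.Sum using (_⊎_; inj₁; inj₂; [_,_]′)
open import Relation.Nullary using (¬_; yes; no; contradiction)
open import Relation.Nullary.Decidable using (decidable-stable)
open import Relation.Binary.PropositionalEquality
open import Function using (_∘_; id)
open import Function.Bundles using (_⇔_; mk⇔)

take-++ : ∀ {A : Set} n {m} (xs : Vec A n) (ys : Vec A m) → take n (xs ++ ys) ≡ xs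
take-++ n xs ys = ++-injectiveˡ _ _ (take++drop≡id n (xs ++ ys))

drop-++ : ∀ {A : Set} n {m} (xs : Vec A n) (ys : Vec A m) → drop n (xs ++ ys) ≡ ys
drop-++ n xs ys = ++-injectiveʳ _ _ (take++drop≡id n (xs ++ ys))

∅ : ∀ {n} → Vec Bool n
∅ = replicate _ false

∅-++ : ∀ n {m} → ∅ {n +ℕ m} ≡ ∅ {n} ++ ∅ {m}
∅-++ zero    = refl
∅-++ (suc n) = cong (false ∷_) (∅-++ n)

or : ∀ {n} → Vec Bool n → Bool
or []      = false
or (b ∷ v) = b ∨ or v

and : ∀ {n} → Vec Bool n → Bool
and []      = true
and (b ∷ v) = b ∧ and v

or-∅ : ∀ n → or (∅ {n}) ≡ false
or-∅ zero    = refl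
or-∅ (suc n) = or-∅ n

or≡false⇒∅ : ∀ {n} (T : Vec Bool n) → or T ≡ false → T ≡ ∅
or≡false⇒∅ []          _  = refl
or≡false⇒∅ (false ∷ T) eq = cong (false ∷_) (or≡false⇒∅ T eq)

or-++ : ∀ {n m} (X : Vec Bool n) (Y : Vec Bool m) → or (X ++ Y) ≡ or X ∨ or Y
or-++ []          Y = refl
or-++ (true ∷ X)  Y = refl
or-++ (false ∷ X) Y = or-++ X Y

card-∅ : ∀ n → card (∅ {n}) ≡ 0
card-∅ zero    = refl
card-∅ (suc n) = card-∅ n

card-++ : ∀ {n m} (X : Vec Bool n) (Y : Vec Bool m) → card (X ++ Y) ≡ card X +ℕ card Y
card-++ []          Y = refl
card-++ (true ∷ X)  Y = cong suc (card-++ X Y)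
card-++ (false ∷ X) Y = card-++ X Y

card-take-drop : ∀ n {m} (S : Vec Bool (n +ℕ m)) → card S ≡ card (take n S) +ℕ card (drop n S)
card-take-drop n S = trans (cong card (sym (take++drop≡id n S))) (card-++ (take n S) _)

card-take≤ : ∀ n {m} (S : Vec Bool (n +ℕ m)) → card (take n S) ≤ card S
card-take≤ n S = subst (card (take n S) ≤_) (sym (card-take-drop n S)) (ℕ.m≤m+n _ _)

card-drop≤ : ∀ n {m} (S : Vec Bool (n +ℕ m)) → card (drop n S) ≤ card S
card-drop≤ n S = subst (card (drop n S) ≤_) (sym (card-take-drop n S)) (ℕ.m≤n+m _ _)

or⇒1≤card : ∀ {n} (T : Vec Bool n) → or T ≡ true → 1 ≤ card T
or⇒1≤card (true ∷ T)  _  = s≤s z≤n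
or⇒1≤card (false ∷ T) eq = or⇒1≤card T eq

1≤card⇒or : ∀ {n} (T : Vec Bool n) → 1 ≤ card T → or T ≡ true
1≤card⇒or (true ∷ T)  _     = refl
1≤card⇒or (false ∷ T) 1≤∣T∣ = 1≤card⇒or T 1≤∣T∣

and⇒card≡length : ∀ {n} (T : Vec Bool n) → and T ≡ true → card T ≡ n
and⇒card≡length []         _  = refl
and⇒card≡length (true ∷ T) eq = cong suc (and⇒card≡length T eq)

card≤length : ∀ {n} (v : Vec Bool n) → card v ≤ n
card≤length []          = z≤n
card≤length (true ∷ v)  = s≤s (card≤length v)
card≤length (false ∷ v) = ℕ.m≤n⇒m≤1+n (card≤length v)

card≡length⇒full : ∀ {n} (v : Vec Bool n) → card v ≡ n → v ≡ replicate n true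
card≡length⇒full []          _  = refl
card≡length⇒full (true ∷ v)  eq = cong (true ∷_) (card≡length⇒full v (ℕ.suc-injective eq))
card≡length⇒full (false ∷ v) eq = contradiction (subst (_≤ _) eq (card≤length v)) ℕ.1+n≰n

card-full : ∀ n → card (replicate n true) ≡ n
card-full zero    = refl
card-full (suc n) = cong suc (card-full n)

flip-∅ : ∀ {n} (S : Vec Bool n) → flip S ∅ ≡ S
flip-∅ []          = refl
flip-∅ (true ∷ S)  = cong (true ∷_) (flip-∅ S)
flip-∅ (false ∷ S) = cong (false ∷_) (flip-∅ S)

*≢0⇒≢0ˡ : ∀ i j → i * j ≢ 0ℤ → i ≢ 0ℤ
*≢0⇒≢0ˡ _ _ nz refl = nz refl

*≢0⇒≢0ʳ : ∀ i j → i * j ≢ 0ℤ → j ≢ 0ℤ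
*≢0⇒≢0ʳ i _ nz refl = nz (ℤ.*-zeroʳ i)

≢0⇒*≢0 : ∀ {i j} → i ≢ 0ℤ → j ≢ 0ℤ → i * j ≢ 0ℤ
≢0⇒*≢0 {i} i≢0 j≢0 ij≡0 = [ i≢0 , j≢0 ]′ (ℤ.i*j≡0⇒i≡0∨j≡0 i ij≡0)

∑ : ∀ n → (Vec Bool n → ℤ) → ℤ
∑ zero    φ = φ []
∑ (suc n) φ = ∑ n (φ ∘ (false ∷_)) + ∑ n (φ ∘ (true ∷_))

∑-cong : ∀ n {φ ψ : Vec Bool n → ℤ} → (∀ S → φ S ≡ ψ S) → ∑ n φ ≡ ∑ n ψ
∑-cong zero    eq = eq []
∑-cong (suc n) eq = cong₂ _+_ (∑-cong n (eq ∘ (false ∷_))) (∑-cong n (eq ∘ (true ∷_)))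

∑-zero : ∀ n {φ : Vec Bool n → ℤ} → (∀ S → φ S ≡ 0ℤ) → ∑ n φ ≡ 0ℤ
∑-zero zero    eq = eq []
∑-zero (suc n) eq = cong₂ _+_ (∑-zero n (eq ∘ (false ∷_))) (∑-zero n (eq ∘ (true ∷_)))

∑-+ : ∀ n (φ ψ : Vec Bool n → ℤ) → ∑ n (λ S → φ S + ψ S) ≡ ∑ n φ + ∑ n ψ
∑-+ zero    φ ψ = refl
∑-+ (suc n) φ ψ = begin
  (∑ n (λ S → φ (false ∷ S) + ψ (false ∷ S))) + ∑ n (λ S → φ (true ∷ S) + ψ (true ∷ S))
    ≡⟨ cong₂ _+_ (∑-+ n _ _) (∑-+ n _ _) ⟩
  (a + b) + (c + d)
    ≡⟨ interchange a b c d ⟩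
  (a + c) + (b + d) ∎
  where
  open ≡-Reasoning
  a = ∑ n (φ ∘ (false ∷_)); b = ∑ n (ψ ∘ (false ∷_))
  c = ∑ n (φ ∘ (true ∷_));  d = ∑ n (ψ ∘ (true ∷_))
  interchange : ∀ a b c d → (a + b) + (c + d) ≡ (a + c) + (b + d)
  interchange = solve-∀

∑-neg : ∀ n (φ : Vec Bool n → ℤ) → ∑ n (λ S → - φ S) ≡ - ∑ n φ
∑-neg zero    φ = refl
∑-neg (suc n) φ = trans (cong₂ _+_ (∑-neg n _) (∑-neg n _)) (sym (ℤ.neg-distrib-+ (∑ n (φ ∘ (false ∷_))) _))

∑-minus : ∀ n (φ ψ : Vec Bool n → ℤ) → ∑ n (λ S → φ S - ψ S) ≡ ∑ n φ - ∑ n ψ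
∑-minus n φ ψ = trans (∑-+ n φ _) (cong (∑ n φ +_) (∑-neg n ψ))

∑-*ˡ : ∀ n a (φ : Vec Bool n → ℤ) → ∑ n (λ S → a * φ S) ≡ a * ∑ n φ
∑-*ˡ zero    a φ = refl
∑-*ˡ (suc n) a φ = trans (cong₂ _+_ (∑-*ˡ n a _) (∑-*ˡ n a _)) (sym (ℤ.*-distribˡ-+ a _ _))

∑-*ʳ : ∀ n a (φ : Vec Bool n → ℤ) → ∑ n (λ S → φ S * a) ≡ ∑ n φ * a
∑-*ʳ n a φ = trans (∑-cong n (λ S → ℤ.*-comm (φ S) a)) (trans (∑-*ˡ n a φ) (ℤ.*-comm a _))

∑-comm : ∀ n m (χ : Vec Bool n → Vec Bool m → ℤ) →
  ∑ n (λ S → ∑ m (χ S)) ≡ ∑ m (λ T → ∑ n (λ S → χ S T))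
∑-comm zero    m χ = refl
∑-comm (suc n) m χ = trans (cong₂ _+_ (∑-comm n m _) (∑-comm n m _)) (sym (∑-+ m _ _))

∑-++ : ∀ n m (χ : Vec Bool (n +ℕ m) → ℤ) → ∑ (n +ℕ m) χ ≡ ∑ n (λ S → ∑ m (λ T → χ (S ++ T)))
∑-++ zero    m χ = refl
∑-++ (suc n) m χ = cong₂ _+_ (∑-++ n m _) (∑-++ n m _)

∑-product : ∀ n m (φ : Vec Bool n → ℤ) (ψ : Vec Bool m → ℤ) →
  ∑ (n +ℕ m) (λ S → φ (take n S) * ψ (drop n S)) ≡ ∑ n φ * ∑ m ψ
∑-product n m φ ψ = begin
  ∑ (n +ℕ m) (λ S → φ (take n S) * ψ (drop n S))
    ≡⟨ ∑-++ n m _ ⟩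
  ∑ n (λ S → ∑ m (λ T → φ (take n (S ++ T)) * ψ (drop n (S ++ T))))
    ≡⟨ ∑-cong n (λ S → ∑-cong m (λ T → cong₂ _*_ (cong φ (take-++ n S T)) (cong ψ (drop-++ n S T)))) ⟩
  ∑ n (λ S → ∑ m (λ T → φ S * ψ T))
    ≡⟨ ∑-cong n (λ S → ∑-*ˡ m (φ S) ψ) ⟩
  ∑ n (λ S → φ S * ∑ m ψ)
    ≡⟨ ∑-*ʳ n _ φ ⟩
  ∑ n φ * ∑ m ψ ∎
  where open ≡-Reasoning

vanishes-off : ∀ {n} {φ : Vec Bool n → ℤ} {V} → (∀ U → φ U ≢ 0ℤ → U ≡ V) → ∀ {U} → U ≢ V → φ U ≡ 0ℤ
vanishes-off {φ = φ} only {U} U≢V = decidable-stable (φ U ≟ 0ℤ) (U≢V ∘ only U)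

∑-single : ∀ n {φ : Vec Bool n → ℤ} V → (∀ U → φ U ≢ 0ℤ → U ≡ V) → ∑ n φ ≡ φ V
∑-single zero    []          only = refl
∑-single (suc n) (false ∷ V) only = trans
  (cong₂ _+_ (∑-single n V (λ U → ∷-injectiveʳ ∘ only _)) (∑-zero n (λ U → vanishes-off only (λ ()))))
  (ℤ.+-identityʳ _)
∑-single (suc n) (true ∷ V)  only = trans
  (cong₂ _+_ (∑-zero n (λ U → vanishes-off only (λ ()))) (∑-single n V (λ U → ∷-injectiveʳ ∘ only _)))
  (ℤ.+-identityˡ _)

monomial-∅ : ∀ {n} (x : Cube n) → monomial ∅ x ≡ 1ℤ
monomial-∅ []      = refl
monomial-∅ (_ ∷ x) = monomial-∅ x

monomial-true∷ : ∀ {n} b (U : Vec Bool n) x → monomial (true ∷ U) (b ∷ x) ≡ toℤ b * monomial U x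
monomial-true∷ true  U x = sym (ℤ.*-identityˡ _)
monomial-true∷ false U x = refl

monomial-split : ∀ n {m} (S y : Vec Bool (n +ℕ m)) →
  monomial S y ≡ monomial (take n S) (take n y) * monomial (drop n S) (drop n y)
monomial-split zero    S           y           = sym (ℤ.*-identityˡ _)
monomial-split (suc n) (false ∷ S) (_ ∷ y)     = monomial-split n S y
monomial-split (suc n) (true ∷ S)  (true ∷ y)  = monomial-split n S y
monomial-split (suc n) (true ∷ S)  (false ∷ y) = refl

eval′ : ∀ {n} → MultilinearPoly n → Cube n → ℤ
eval′ {n} c x = ∑ n (λ S → c S * monomial S x)

sumℤ-++ : ∀ xs ys → sumℤ (xs List.++ ys) ≡ sumℤ xs + sumℤ ys
sumℤ-++ List.[]       ys = sym (ℤ.+-identityˡ _)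
sumℤ-++ (x List.∷ xs) ys = trans (cong (x +_) (sumℤ-++ xs ys)) (sym (ℤ.+-assoc x _ _))

sumℤ-allVecs : ∀ n (φ : Vec Bool n → ℤ) → sumℤ (List.map φ (allVecs n)) ≡ ∑ n φ
sumℤ-allVecs zero    φ = ℤ.+-identityʳ _
sumℤ-allVecs (suc n) φ = begin
  sumℤ (List.map φ (List.map (false ∷_) A List.++ List.map (true ∷_) A))
    ≡⟨ cong sumℤ (Listₚ.map-++ φ (List.map (false ∷_) A) _) ⟩
  sumℤ (List.map φ (List.map (false ∷_) A) List.++ List.map φ (List.map (true ∷_) A))
    ≡⟨ sumℤ-++ (List.map φ (List.map (false ∷_) A)) _ ⟩
  sumℤ (List.map φ (List.map (false ∷_) A)) + sumℤ (List.map φ (List.map (true ∷_) A))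
    ≡⟨ cong₂ _+_ (cong sumℤ (sym (Listₚ.map-∘ A))) (cong sumℤ (sym (Listₚ.map-∘ A))) ⟩
  sumℤ (List.map (φ ∘ (false ∷_)) A) + sumℤ (List.map (φ ∘ (true ∷_)) A)
    ≡⟨ cong₂ _+_ (sumℤ-allVecs n _) (sumℤ-allVecs n _) ⟩
  ∑ (suc n) φ ∎
  where
  open ≡-Reasoning
  A = allVecs n

eval≡eval′ : ∀ {n} (c : MultilinearPoly n) x → eval c x ≡ eval′ c x
eval≡eval′ {n} c x = sumℤ-allVecs n _

Represents : ∀ {n} → MultilinearPoly n → BoolFun n → Set
Represents c f = ∀ x → eval′ c x ≡ toℤ (f x)

eval′-minus : ∀ {n} (c d : MultilinearPoly n) x → eval′ (λ S → c S - d S) x ≡ eval′ c x - eval′ d x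
eval′-minus {n} c d x = trans (∑-cong n (λ S → distrib (c S) (d S) _)) (∑-minus n _ _)
  where
  distrib : ∀ c d m → (c - d) * m ≡ c * m - d * m
  distrib = solve-∀

∑-separable : ∀ n m (a : MultilinearPoly n) (b : MultilinearPoly m) (y : Cube (n +ℕ m)) →
  ∑ (n +ℕ m) (λ S → (a (take n S) * b (drop n S)) * monomial S y) ≡ eval′ a (take n y) * eval′ b (drop n y)
∑-separable n m a b y = trans (∑-cong (n +ℕ m) regroup) (∑-product n m _ _)
  where
  interchange : ∀ a b c d → (a * b) * (c * d) ≡ (a * c) * (b * d)
  interchange = solve-∀
  regroup : ∀ S → (a (take n S) * b (drop n S)) * monomial S y
              ≡ (a (take n S) * monomial (take n S) (take n y)) * (b (drop n S) * monomial (drop n S) (drop n y))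
  regroup S = trans (cong (a (take n S) * b (drop n S) *_) (monomial-split n S y))
                    (interchange (a (take n S)) (b (drop n S)) (monomial (take n S) (take n y)) _)

onePoly : ∀ {n} → MultilinearPoly n
onePoly T = if or T then 0ℤ else 1ℤ

∑-onePoly : ∀ n (ψ : Vec Bool n → ℤ) → ∑ n (λ T → onePoly T * ψ T) ≡ ψ ∅
∑-onePoly zero    ψ = ℤ.*-identityˡ _
∑-onePoly (suc n) ψ = trans (cong₂ _+_ (∑-onePoly n (ψ ∘ (false ∷_))) (∑-zero n (λ _ → refl))) (ℤ.+-identityʳ _)

onePoly-represents : ∀ {n} → Represents (onePoly {n}) (λ _ → true)
onePoly-represents {n} x = trans (∑-onePoly n _) (monomial-∅ x)

onePoly-∅ : ∀ n → onePoly (∅ {n}) ≡ 1ℤ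
onePoly-∅ n rewrite or-∅ n = refl

onePoly≢0⇒∅ : ∀ {n} (T : Vec Bool n) → onePoly T ≢ 0ℤ → T ≡ ∅
onePoly≢0⇒∅ T nz with or T in eq
... | false = or≡false⇒∅ T eq
... | true  = contradiction refl nz

module _ (N : ℕ) where

  mapBlocks : ∀ {X : Set} r → (Vec Bool N → X) → Vec Bool (r *ℕ N) → Vec X r
  mapBlocks zero    F S = []
  mapBlocks (suc r) F S = F (take N S) ∷ mapBlocks r F (drop N S)

  mapBlocks-++ : ∀ {X : Set} r (F : Vec Bool N → X) T S → mapBlocks (suc r) F (T ++ S) ≡ F T ∷ mapBlocks r F S
  mapBlocks-++ r F T S = cong₂ _∷_ (cong F (take-++ N T S)) (cong (mapBlocks r F) (drop-++ N T S))

  support : ∀ r → Vec Bool (r *ℕ N) → Vec Bool r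
  support r = mapBlocks r or

  support-∅ : ∀ r → support r ∅ ≡ ∅
  support-∅ zero    = refl
  support-∅ (suc r) = begin
    support (suc r) ∅            ≡⟨ cong (support (suc r)) (∅-++ N {r *ℕ N}) ⟩
    support (suc r) (∅ {N} ++ ∅) ≡⟨ mapBlocks-++ r or ∅ ∅ ⟩
    or (∅ {N}) ∷ support r ∅     ≡⟨ cong₂ _∷_ (or-∅ N) (support-∅ r) ⟩
    ∅ ∎
    where open ≡-Reasoning

  -- The coefficients of ∏_{i ∈ U} h(i-th block of x), a polynomial in r·N variables.
  blockProduct : ∀ r → MultilinearPoly N → Vec Bool r → MultilinearPoly (r *ℕ N)
  blockProduct zero    h []          S = 1ℤ
  blockProduct (suc r) h (true ∷ U)  S = h (take N S) * blockProduct r h U (drop N S)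
  blockProduct (suc r) h (false ∷ U) S = onePoly (take N S) * blockProduct r h U (drop N S)

  compose : ∀ r → MultilinearPoly r → MultilinearPoly N → MultilinearPoly (r *ℕ N)
  compose r G h S = ∑ r (λ U → G U * blockProduct r h U S)

  eval′-blockProduct : ∀ {h f} → Represents h f → ∀ r U y → eval′ (blockProduct r h U) y ≡ monomial U (mapBlocks r f y)
  eval′-blockProduct rep zero [] [] = refl
  eval′-blockProduct {h} {f} rep (suc r) (true ∷ U) y = begin
    eval′ (blockProduct (suc r) h (true ∷ U)) y
      ≡⟨ ∑-separable N (r *ℕ N) h (blockProduct r h U) y ⟩
    eval′ h (take N y) * eval′ (blockProduct r h U) (drop N y)
      ≡⟨ cong₂ _*_ (rep (take N y)) (eval′-blockProduct rep r U (drop N y)) ⟩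
    toℤ (f (take N y)) * monomial U (mapBlocks r f (drop N y))
      ≡⟨ monomial-true∷ (f (take N y)) U _ ⟨
    monomial (true ∷ U) (mapBlocks (suc r) f y) ∎
    where open ≡-Reasoning
  eval′-blockProduct {h} {f} rep (suc r) (false ∷ U) y = begin
    eval′ (blockProduct (suc r) h (false ∷ U)) y
      ≡⟨ ∑-separable N (r *ℕ N) onePoly (blockProduct r h U) y ⟩
    eval′ onePoly (take N y) * eval′ (blockProduct r h U) (drop N y)
      ≡⟨ cong₂ _*_ (onePoly-represents (take N y)) (eval′-blockProduct rep r U (drop N y)) ⟩
    1ℤ * monomial U (mapBlocks r f (drop N y))
      ≡⟨ ℤ.*-identityˡ _ ⟩
    monomial (false ∷ U) (mapBlocks (suc r) f y) ∎
    where open ≡-Reasoning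

  eval′-compose : ∀ {h f} → Represents h f → ∀ r G y → eval′ (compose r G h) y ≡ eval′ G (mapBlocks r f y)
  eval′-compose {h} {f} rep r G y = begin
    ∑ (r *ℕ N) (λ S → ∑ r (λ U → G U * blockProduct r h U S) * monomial S y)
      ≡⟨ ∑-cong (r *ℕ N) (λ S → trans (sym (∑-*ʳ r _ _)) (∑-cong r (λ U → ℤ.*-assoc (G U) _ _))) ⟩
    ∑ (r *ℕ N) (λ S → ∑ r (λ U → G U * (blockProduct r h U S * monomial S y)))
      ≡⟨ ∑-comm (r *ℕ N) r _ ⟩
    ∑ r (λ U → ∑ (r *ℕ N) (λ S → G U * (blockProduct r h U S * monomial S y)))
      ≡⟨ ∑-cong r (λ U → ∑-*ˡ (r *ℕ N) (G U) _) ⟩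
    ∑ r (λ U → G U * eval′ (blockProduct r h U) y)
      ≡⟨ ∑-cong r (λ U → cong (G U *_) (eval′-blockProduct rep r U y)) ⟩
    eval′ G (mapBlocks r f y) ∎
    where open ≡-Reasoning

  module _ {h : MultilinearPoly N} (h∅≡0 : h ∅ ≡ 0ℤ) where

    h≢0⇒nonempty : ∀ T → h T ≢ 0ℤ → or T ≡ true
    h≢0⇒nonempty T hT≢0 with or T in eq
    ... | true  = refl
    ... | false = contradiction (trans (cong h (or≡false⇒∅ T eq)) h∅≡0) hT≢0

    blockProduct≢0⇒support : ∀ r U S → blockProduct r h U S ≢ 0ℤ → U ≡ support r S
    blockProduct≢0⇒support zero    []          S nz = refl
    blockProduct≢0⇒support (suc r) (true ∷ U)  S nz = cong₂ _∷_
      (sym (h≢0⇒nonempty (take N S) (*≢0⇒≢0ˡ (h (take N S)) rest nz)))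
      (blockProduct≢0⇒support r U (drop N S) (*≢0⇒≢0ʳ (h (take N S)) rest nz))
      where rest = blockProduct r h U (drop N S)
    blockProduct≢0⇒support (suc r) (false ∷ U) S nz = cong₂ _∷_
      (sym (trans (cong or (onePoly≢0⇒∅ (take N S) (*≢0⇒≢0ˡ (onePoly (take N S)) rest nz))) (or-∅ N)))
      (blockProduct≢0⇒support r U (drop N S) (*≢0⇒≢0ʳ (onePoly (take N S)) rest nz))
      where rest = blockProduct r h U (drop N S)

    compose-coefficient : ∀ r G S → compose r G h S ≡ G (support r S) * blockProduct r h (support r S) S
    compose-coefficient r G S =
      ∑-single r (support r S) (λ U nz → blockProduct≢0⇒support r U S (*≢0⇒≢0ʳ (G U) _ nz))

    compose-∅ : ∀ r G → G ∅ ≡ 0ℤ → compose r G h ∅ ≡ 0ℤ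
    compose-∅ r G G∅≡0 = begin
      compose r G h ∅                                      ≡⟨ compose-coefficient r G ∅ ⟩
      G (support r ∅) * blockProduct r h (support r ∅) ∅   ≡⟨ cong (λ U → G U * blockProduct r h U ∅) (support-∅ r) ⟩
      G ∅ * blockProduct r h ∅ ∅                           ≡⟨ cong (_* blockProduct r h ∅ ∅) G∅≡0 ⟩
      0ℤ ∎
      where open ≡-Reasoning

  blockProduct≢0⇒card≤ : ∀ {h D} → (∀ T → h T ≢ 0ℤ → card T ≤ D) →
    ∀ r U S → blockProduct r h U S ≢ 0ℤ → card S ≤ card U *ℕ D
  blockProduct≢0⇒card≤ h-bound zero    []          [] nz = z≤n
  blockProduct≢0⇒card≤ {h} h-bound (suc r) (true ∷ U) S nz = begin
    card S                                 ≡⟨ card-take-drop N S ⟩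
    card (take N S) +ℕ card (drop N S)     ≤⟨ ℕ.+-mono-≤ (h-bound _ (*≢0⇒≢0ˡ (h (take N S)) rest nz))
                                                (blockProduct≢0⇒card≤ h-bound r U _ (*≢0⇒≢0ʳ (h (take N S)) rest nz)) ⟩
    card (true ∷ U) *ℕ _                   ∎
    where
    open ℕ.≤-Reasoning
    rest = blockProduct r h U (drop N S)
  blockProduct≢0⇒card≤ {h} h-bound (suc r) (false ∷ U) S nz = begin
    card S                                 ≡⟨ card-take-drop N S ⟩
    card (take N S) +ℕ card (drop N S)     ≡⟨ cong (_+ℕ card (drop N S)) empty-block ⟩
    card (drop N S)                        ≤⟨ blockProduct≢0⇒card≤ h-bound r U _ (*≢0⇒≢0ʳ (onePoly (take N S)) rest nz) ⟩
    card (false ∷ U) *ℕ _                  ∎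
    where
    open ℕ.≤-Reasoning
    rest = blockProduct r h U (drop N S)
    empty-block : card (take N S) ≡ 0
    empty-block = trans (cong card (onePoly≢0⇒∅ (take N S) (*≢0⇒≢0ˡ _ rest nz))) (card-∅ N)

  tile : ∀ {r} → Vec Bool N → Vec Bool r → Vec Bool (r *ℕ N)
  tile T U = concat (map (λ u → if u then T else ∅) U)

  card-tile : ∀ {r} T (U : Vec Bool r) → card (tile T U) ≡ card U *ℕ card T
  card-tile T []          = refl
  card-tile T (true ∷ U)  = trans (card-++ T _) (cong (card T +ℕ_) (card-tile T U))
  card-tile T (false ∷ U) = trans (card-++ (∅ {N}) _) (cong₂ _+ℕ_ (card-∅ N) (card-tile T U))

  support-tile : ∀ {r} T → or T ≡ true → (U : Vec Bool r) → support r (tile T U) ≡ U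
  support-tile T orT []          = refl
  support-tile T orT (true ∷ U)  = trans (mapBlocks-++ _ or T _) (cong₂ _∷_ orT (support-tile T orT U))
  support-tile T orT (false ∷ U) = trans (mapBlocks-++ _ or ∅ _) (cong₂ _∷_ (or-∅ N) (support-tile T orT U))

  blockProduct-tile≢0 : ∀ h T → h T ≢ 0ℤ → ∀ {r} (U : Vec Bool r) → blockProduct r h U (tile T U) ≢ 0ℤ
  blockProduct-tile≢0 h T hT≢0 [] = λ ()
  blockProduct-tile≢0 h T hT≢0 (true ∷ U)
    rewrite take-++ N T (tile T U) | drop-++ N T (tile T U)
    = ≢0⇒*≢0 hT≢0 (blockProduct-tile≢0 h T hT≢0 U)
  blockProduct-tile≢0 h T hT≢0 (false ∷ U)
    rewrite take-++ N (∅ {N}) (tile T U) | drop-++ N (∅ {N}) (tile T U) | onePoly-∅ N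
    = ≢0⇒*≢0 {1ℤ} (λ ()) (blockProduct-tile≢0 h T hT≢0 U)

  compose-degree : ∀ {r G h a D} → h ∅ ≡ 0ℤ → HasDegree G a → HasDegree h D → HasDegree (compose r G h) (a *ℕ D)
  compose-degree {r} {G} {h} {a} {D} h∅≡0 ((U , GU≢0 , ∣U∣≡a) , G-bound) ((T , hT≢0 , ∣T∣≡D) , h-bound) =
    (tile T U , witness≢0 , trans (card-tile T U) (cong₂ _*ℕ_ ∣U∣≡a ∣T∣≡D)) , bound
    where
    witness-coefficient : compose r G h (tile T U) ≡ G U * blockProduct r h U (tile T U)
    witness-coefficient = trans (compose-coefficient h∅≡0 r G (tile T U))
      (cong (λ V → G V * blockProduct r h V (tile T U)) (support-tile T (h≢0⇒nonempty h∅≡0 T hT≢0) U))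
    witness≢0 : compose r G h (tile T U) ≢ 0ℤ
    witness≢0 = ≢0⇒*≢0 GU≢0 (blockProduct-tile≢0 h T hT≢0 U) ∘ trans (sym witness-coefficient)
    bound : ∀ S → compose r G h S ≢ 0ℤ → card S ≤ a *ℕ D
    bound S nz = ℕ.≤-trans
      (blockProduct≢0⇒card≤ h-bound r _ S (*≢0⇒≢0ʳ (G (support r S)) _ leading≢0))
      (ℕ.*-monoˡ-≤ D (G-bound _ (*≢0⇒≢0ˡ _ (blockProduct r h (support r S) S) leading≢0)))
      where
      leading≢0 : G (support r S) * blockProduct r h (support r S) S ≢ 0ℤ
      leading≢0 = nz ∘ trans (compose-coefficient h∅≡0 r G S)

nonConstant : ∀ {r} → Vec Bool r → Bool
nonConstant z = or z ∧ not (and z)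

allFalsePoly : ∀ {r} → MultilinearPoly r
allFalsePoly []          = 1ℤ
allFalsePoly (false ∷ U) = allFalsePoly U
allFalsePoly (true ∷ U)  = - allFalsePoly U

allTruePoly : ∀ {r} → MultilinearPoly r
allTruePoly []          = 1ℤ
allTruePoly (false ∷ U) = 0ℤ
allTruePoly (true ∷ U)  = allTruePoly U

nonConstantPoly : ∀ {r} → MultilinearPoly r
nonConstantPoly U = (onePoly U - allFalsePoly U) - allTruePoly U

allFalsePoly-represents : ∀ {r} → Represents (allFalsePoly {r}) (not ∘ or)
allFalsePoly-represents         []          = refl
allFalsePoly-represents {suc r} (false ∷ z) =
  trans (cong₂ _+_ (allFalsePoly-represents z) (∑-zero r (λ U → ℤ.*-zeroʳ (- allFalsePoly U))))
        (ℤ.+-identityʳ _)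
allFalsePoly-represents {suc r} (true ∷ z)  = begin
  eval′ allFalsePoly z + ∑ r (λ U → - allFalsePoly U * monomial U z)
    ≡⟨ cong (eval′ allFalsePoly z +_) (trans (∑-cong r (λ U → sym (ℤ.neg-distribˡ-* (allFalsePoly U) (monomial U z))))
                                              (∑-neg r _)) ⟩
  eval′ allFalsePoly z - eval′ allFalsePoly z
    ≡⟨ ℤ.+-inverseʳ (eval′ allFalsePoly z) ⟩
  0ℤ ∎
  where open ≡-Reasoning

allTruePoly-represents : ∀ {r} → Represents (allTruePoly {r}) and
allTruePoly-represents         []          = refl
allTruePoly-represents {suc r} (false ∷ z) =
  cong₂ _+_ (∑-zero r (λ _ → refl)) (∑-zero r (λ U → ℤ.*-zeroʳ (allTruePoly U)))
allTruePoly-represents {suc r} (true ∷ z)  =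
  trans (cong₂ _+_ (∑-zero r (λ _ → refl)) (allTruePoly-represents z)) (ℤ.+-identityˡ _)

nonConstant-toℤ : ∀ {r} (z : Vec Bool (suc r)) → (1ℤ - toℤ (not (or z))) - toℤ (and z) ≡ toℤ (nonConstant z)
nonConstant-toℤ (true ∷ z) with and z
... | true  = refl
... | false = refl
nonConstant-toℤ (false ∷ z) with or z
... | true  = refl
... | false = refl

nonConstantPoly-represents : ∀ {r} → Represents (nonConstantPoly {suc r}) nonConstant
nonConstantPoly-represents z = begin
  eval′ nonConstantPoly z
    ≡⟨ eval′-minus (λ U → onePoly U - allFalsePoly U) allTruePoly z ⟩
  eval′ (λ U → onePoly U - allFalsePoly U) z - eval′ allTruePoly z
    ≡⟨ cong (_- eval′ allTruePoly z) (eval′-minus onePoly allFalsePoly z) ⟩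
  (eval′ onePoly z - eval′ allFalsePoly z) - eval′ allTruePoly z
    ≡⟨ cong₂ _-_ (cong₂ _-_ (onePoly-represents z) (allFalsePoly-represents z)) (allTruePoly-represents z) ⟩
  (1ℤ - toℤ (not (or z))) - toℤ (and z)
    ≡⟨ nonConstant-toℤ z ⟩
  toℤ (nonConstant z) ∎
  where open ≡-Reasoning

allFalsePoly-∅ : ∀ r → allFalsePoly (∅ {r}) ≡ 1ℤ
allFalsePoly-∅ zero    = refl
allFalsePoly-∅ (suc r) = allFalsePoly-∅ r

allFalsePoly-full : ∀ {K} → 2 ∣ K → allFalsePoly (replicate K true) ≡ 1ℤ
allFalsePoly-full (divides q refl) = even q
  where
  even : ∀ q → allFalsePoly (replicate (q *ℕ 2) true) ≡ 1ℤ
  even zero    = refl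
  even (suc q) = trans (ℤ.neg-involutive _) (even q)

allTruePoly-full : ∀ n → allTruePoly (replicate n true) ≡ 1ℤ
allTruePoly-full zero    = refl
allTruePoly-full (suc n) = allTruePoly-full n

nonConstantPoly-∅ : ∀ r → nonConstantPoly (∅ {suc r}) ≡ 0ℤ
nonConstantPoly-∅ r rewrite onePoly-∅ r | allFalsePoly-∅ r = refl

nonConstantPoly-degree : ∀ {K} → 1 ≤ K → 2 ∣ K → HasDegree (nonConstantPoly {suc K}) K
nonConstantPoly-degree {suc K} _ 2∣K = (false ∷ replicate (suc K) true , witness≢0 , card-full (suc K)) , bound
  where
  witness≢0 : nonConstantPoly (false ∷ replicate (suc K) true) ≢ 0ℤ
  witness≢0 rewrite allFalsePoly-full 2∣K = λ ()
  full≡0 : nonConstantPoly (replicate (suc (suc K)) true) ≡ 0ℤ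
  full≡0 rewrite allFalsePoly-full 2∣K | allTruePoly-full (suc K) = refl
  bound : ∀ U → nonConstantPoly U ≢ 0ℤ → card U ≤ suc K
  bound U nz with card U ℕ.≟ suc (suc K)
  ... | yes ∣U∣≡K+1 = contradiction (trans (cong nonConstantPoly (card≡length⇒full U ∣U∣≡K+1)) full≡0) nz
  ... | no  ∣U∣≢K+1 = ℕ.≤-pred (ℕ.≤∧≢⇒< (card≤length U) ∣U∣≢K+1)

module _ (N : ℕ) where

  or-support : ∀ r S → or (support N r S) ≡ or S
  or-support zero    [] = refl
  or-support (suc r) S = begin
    or (take N S) ∨ or (support N r (drop N S)) ≡⟨ cong (or (take N S) ∨_) (or-support r (drop N S)) ⟩
    or (take N S) ∨ or (drop N S)               ≡⟨ or-++ (take N S) _ ⟨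
    or (take N S ++ drop N S)                   ≡⟨ cong or (take++drop≡id N S) ⟩
    or S ∎
    where open ≡-Reasoning

  card-support : ∀ r S → card (support N r S) ≤ card S
  card-support zero    S = z≤n
  card-support (suc r) S with or (take N S) in eq
  ... | true  = begin
    suc (card (support N r (drop N S)))  ≤⟨ ℕ.+-mono-≤ (or⇒1≤card (take N S) eq) (card-support r _) ⟩
    card (take N S) +ℕ card (drop N S)   ≡⟨ card-take-drop N S ⟨
    card S                               ∎
    where open ℕ.≤-Reasoning
  ... | false = ℕ.≤-trans (card-support r _) (card-drop≤ N S)

  mapBlocks-lowWeight : ∀ {F : Vec Bool N → Bool} {K} → (∀ T → card T ≤ K → F T ≡ or T) →
    ∀ r S → card S ≤ K → mapBlocks N r F S ≡ support N r S
  mapBlocks-lowWeight low zero    S _      = refl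
  mapBlocks-lowWeight low (suc r) S ∣S∣≤K = cong₂ _∷_
    (low _ (ℕ.≤-trans (card-take≤ N S) ∣S∣≤K))
    (mapBlocks-lowWeight low r _ (ℕ.≤-trans (card-drop≤ N S) ∣S∣≤K))

  nonConstant-support : ∀ K S → card S ≤ K → nonConstant (support N (suc K) S) ≡ or S
  nonConstant-support K S ∣S∣≤K with and (support N (suc K) S) in eq
  ... | true  = contradiction
    (ℕ.≤-trans (ℕ.≤-reflexive (sym (and⇒card≡length (support N (suc K) S) eq))) (ℕ.≤-trans (card-support (suc K) S) ∣S∣≤K))
    ℕ.1+n≰n
  ... | false = trans (∧-identityʳ _) (or-support (suc K) S)

or-on-lowWeight⇒sensitive : ∀ {n} {f : BoolFun n} {k} K → k ≤ K →
  (∀ S → card S ≤ K → f S ≡ or S) → KthOrderSensitive k f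
or-on-lowWeight⇒sensitive {n} {f} K k≤K low = ∅ , λ S 1≤∣S∣ ∣S∣≤k f∅≡fS → false≢true (begin
  false        ≡⟨ or-∅ n ⟨
  or (∅ {n})   ≡⟨ low ∅ (subst (_≤ K) (sym (card-∅ n)) z≤n) ⟨
  f ∅          ≡⟨ f∅≡fS ⟩
  f (flip S ∅) ≡⟨ cong f (flip-∅ S) ⟩
  f S          ≡⟨ low S (ℕ.≤-trans ∣S∣≤k k≤K) ⟩
  or S         ≡⟨ 1≤card⇒or S 1≤∣S∣ ⟩
  true         ∎)
  where
  open ≡-Reasoning
  false≢true : false ≢ true
  false≢true ()

module _ (K : ℕ) where

  nonConstantTree : ∀ m → BoolFun (suc K ^ m)
  nonConstantTree zero    (b ∷ []) = b
  nonConstantTree (suc m) = nonConstant ∘ mapBlocks (suc K ^ m) (suc K) (nonConstantTree m)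

  nonConstantTreePoly : ∀ m → MultilinearPoly (suc K ^ m)
  nonConstantTreePoly zero    (b ∷ []) = toℤ b
  nonConstantTreePoly (suc m) = compose (suc K ^ m) (suc K) nonConstantPoly (nonConstantTreePoly m)

  nonConstantTreePoly-represents : ∀ m → Represents (nonConstantTreePoly m) (nonConstantTree m)
  nonConstantTreePoly-represents zero    (true ∷ [])  = refl
  nonConstantTreePoly-represents zero    (false ∷ []) = refl
  nonConstantTreePoly-represents (suc m) y = trans
    (eval′-compose (suc K ^ m) (nonConstantTreePoly-represents m) (suc K) nonConstantPoly y)
    (nonConstantPoly-represents (mapBlocks (suc K ^ m) (suc K) (nonConstantTree m) y))

  nonConstantTreePoly-∅ : ∀ m → nonConstantTreePoly m ∅ ≡ 0ℤ
  nonConstantTreePoly-∅ zero    = refl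
  nonConstantTreePoly-∅ (suc m) =
    compose-∅ (suc K ^ m) (nonConstantTreePoly-∅ m) (suc K) nonConstantPoly (nonConstantPoly-∅ K)

  nonConstantTreePoly-degree : 1 ≤ K → 2 ∣ K → ∀ m → HasDegree (nonConstantTreePoly m) (K ^ m)
  nonConstantTreePoly-degree _ _ zero = ((true ∷ []) , (λ ()) , refl) , bound
    where
    bound : ∀ S → nonConstantTreePoly zero S ≢ 0ℤ → card S ≤ 1
    bound (true ∷ [])  _  = s≤s z≤n
    bound (false ∷ []) nz = contradiction refl nz
  nonConstantTreePoly-degree 1≤K 2∣K (suc m) = compose-degree (suc K ^ m) (nonConstantTreePoly-∅ m)
    (nonConstantPoly-degree 1≤K 2∣K) (nonConstantTreePoly-degree 1≤K 2∣K m)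

  nonConstantTree-lowWeight : ∀ m S → card S ≤ K → nonConstantTree m S ≡ or S
  nonConstantTree-lowWeight zero    (true ∷ [])  _ = refl
  nonConstantTree-lowWeight zero    (false ∷ []) _ = refl
  nonConstantTree-lowWeight (suc m) S ∣S∣≤K = trans
    (cong nonConstant (mapBlocks-lowWeight (suc K ^ m) (nonConstantTree-lowWeight m) (suc K) S ∣S∣≤K))
    (nonConstant-support (suc K ^ m) K S ∣S∣≤K)

n<b^n : ∀ b → 1 < b → ∀ n → n < b ^ n
n<b^n b 1<b zero    = s≤s z≤n
n<b^n b 1<b (suc n) = ℕ.≤-<-trans (n<b^n b 1<b n) (ℕ.^-monoʳ-< b 1<b (ℕ.n<1+n n))

^-<-⇔ : ∀ m x y → x ^ suc m < y ^ suc m ⇔ x < y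
^-<-⇔ m x y = mk⇔ cancel (ℕ.^-monoˡ-< (suc m))
  where
  cancel : x ^ suc m < y ^ suc m → x < y
  cancel xᵐ<yᵐ with x ℕ.<? y
  ... | yes x<y = x<y
  ... | no  x≮y = contradiction xᵐ<yᵐ (ℕ.≤⇒≯ (ℕ.^-monoˡ-≤ (suc m) (ℕ.≮⇒≥ x≮y)))

^-^-comm : ∀ x m q → (x ^ m) ^ q ≡ (x ^ q) ^ m
^-^-comm x m q = trans (ℕ.^-*-assoc x m q) (trans (cong (x ^_) (ℕ.*-comm m q)) (sym (ℕ.^-*-assoc x q m)))

^-ratio-< : ∀ m a b p q → (a ^ suc m) ^ q < (b ^ suc m) ^ p ⇔ a ^ q < b ^ p
^-ratio-< m a b p q rewrite ^-^-comm a (suc m) q | ^-^-comm b (suc m) p = ^-<-⇔ m (a ^ q) (b ^ p)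

IsPowLogRatio-^ : ∀ m a b → 2 ≤ b → IsPowLogRatio (a ^ suc m) (b ^ suc m) a b
IsPowLogRatio-^ m a b 2≤b =
  ℕ.≤-trans (s≤s (s≤s z≤n)) (n<b^n b 2≤b (suc m)) , λ p q _ → ^-ratio-< m a b p q , ^-ratio-< m b a q p

2∣n⊎2∣1+n : ∀ n → 2 ∣ n ⊎ 2 ∣ suc n
2∣n⊎2∣1+n zero    = inj₁ (divides 0 refl)
2∣n⊎2∣1+n (suc n) = [ inj₂ ∘ ∣m∣n⇒∣m+n ∣-refl , inj₁ ]′ (2∣n⊎2∣1+n n)

2∤n⇒2∣1+n : ∀ {n} → ¬ 2 ∣ n → 2 ∣ suc n
2∤n⇒2∣1+n {n} 2∤n = [ (λ 2∣n → contradiction 2∣n 2∤n) , id ]′ (2∣n⊎2∣1+n n)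

SensitiveWithPdeg : ℕ → ℕ → (ℕ → ℕ → Set) → Set
SensitiveWithPdeg k N P =
  ∃ λ (n : ℕ) → N ≤ n × ∃ λ (f : BoolFun n) → KthOrderSensitive k f × ∃ λ (d : ℕ) → HasPdeg f d × P d n

SensitiveWithPdeg-map : ∀ {k N} {P Q : ℕ → ℕ → Set} → (∀ {d n} → P d n → Q d n) →
  SensitiveWithPdeg k N P → SensitiveWithPdeg k N Q
SensitiveWithPdeg-map P⇒Q (n , N≤n , f , sensitive , d , pdeg , p) = n , N≤n , f , sensitive , d , pdeg , P⇒Q p

nonConstantTree-sensitiveWithPdeg : ∀ K → 1 ≤ K → 2 ∣ K → ∀ {k} → k ≤ K → ∀ N →
  SensitiveWithPdeg k N (λ d n → IsPowLogRatio d n K (suc K))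
nonConstantTree-sensitiveWithPdeg K 1≤K 2∣K k≤K N =
  suc K ^ m , N≤n , nonConstantTree K m ,
  or-on-lowWeight⇒sensitive K k≤K (nonConstantTree-lowWeight K m) ,
  K ^ m , pdeg , IsPowLogRatio-^ N K (suc K) (s≤s 1≤K)
  where
  m = suc N
  N≤n : N ≤ suc K ^ m
  N≤n = ℕ.≤-trans (ℕ.n≤1+n N) (ℕ.<⇒≤ (n<b^n (suc K) (s≤s 1≤K) m))
  pdeg : HasPdeg (nonConstantTree K m) (K ^ m)
  pdeg = nonConstantTreePoly K m ,
         (λ x → trans (eval≡eval′ (nonConstantTreePoly K m) x) (nonConstantTreePoly-represents K m x)) ,
         nonConstantTreePoly-degree K 1≤K 2∣K m

mainTheorem9 : ∀ (k : ℕ) → 1 ≤ k → ∀ (N : ℕ) →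
    ∃ λ (n : ℕ) → N ≤ n × ∃ λ (f : BoolFun n) → KthOrderSensitive k f ×
      ∃ λ (d : ℕ) → HasPdeg f d ×
        ((2 ∣ k → IsPowLogRatio d n k (suc k)) ×
         (¬ (2 ∣ k) → IsPowLogRatio d n (suc k) (suc (suc k))))
mainTheorem9 k 1≤k N with 2 ∣? k
... | yes 2∣k = SensitiveWithPdeg-map (λ ratio → (λ _ → ratio) , contradiction 2∣k)
  (nonConstantTree-sensitiveWithPdeg k 1≤k 2∣k ℕ.≤-refl N)
... | no  2∤k = SensitiveWithPdeg-map (λ ratio → (λ 2∣k → contradiction 2∣k 2∤k) , (λ _ → ratio))
  (nonConstantTree-sensitiveWithPdeg (suc k) (s≤s z≤n) (2∤n⇒2∣1+n 2∤k) (ℕ.n≤1+n k) N)
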